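{- Let $T$ be a tournament with $T\notin\mathcal{D}_1$. Then $T\in\xi(L_4)$, i.e. $T$ contains a subtournament which is switching isomorphic to $L_4$.
   Context: A tournament is a digraph with exactly one arc between each pair of distinct vertices. Skew-adjacency matrix $S_T$: entry $1$ if $v_i\to v_j$, $-1$ if $v_j\to v_i$, $0$ on the diagonal; $\det(T)=\det(S_T)$. $\mathcal{D}_1$ is the set of tournaments all of whose induced subtournaments have determinant at most $1$. The switch of $T$ w.r.t. $W\subseteq V(T)$ reverses all arcs between $W$ and $V(T)\setminus W$; $T_1$ is switching isomorphic to $T_2$ if some switch of $T_1$ is isomorphic to $T_2$. $\xi(H)$ is the set of tournaments containing a subtournament switching isomorphic to $H$. $L_4$ is the tournament on $v_1,v_2,v_3,v_4$ with $v_1\to v_2$, $v_1\to v_3$, $v_2\to v_3$, $v_4\to v_1$, $v_2\to v_4$, $v_4\to v_3$. -}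

module Defs where

open import Data.Nat using (ℕ; zero; suc)
open import Data.Fin using (Fin; zero; suc; punchIn; toℕ; _≟_)
open import Data.Fin.Permutation using (Permutation′; _⟨$⟩ʳ_)
open import Data.Bool using (Bool; true; false; not; _xor_; if_then_else_)
open import Data.Integer using (ℤ; +_; -_; _+_; _*_; _≤_)
open import Data.Product using (Σ; ∃; ∃-syntax; _×_; _,_)
open import Relation.Nullary using (¬_; yes; no)
open import Relation.Binary.PropositionalEquality using (_≡_; _≢_; refl)
open import Data.Empty using (⊥-elim)
open import Function.Definitions using (Injective)

-- A tournament on vertex set Fin n: arc i j = true means i → j.
-- For distinct i, j exactly one of i → j, j → i holds.
-- (Diagonal values of arc are irrelevant and never used.)
record Tournament (n : ℕ) : Set where
  field
    arc   : Fin n → Fin n → Bool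
    tourn : ∀ i j → i ≢ j → arc i j ≡ not (arc j i)
open Tournament public

Matrix : ℕ → Set
Matrix n = Fin n → Fin n → ℤ

sign : ℕ → ℤ
sign zero = + 1
sign (suc zero) = - (+ 1)
sign (suc (suc k)) = sign k

minor : ∀ {n} → Matrix (suc n) → Fin (suc n) → Matrix n
minor A j r c = A (suc r) (punchIn j c)

sumFin : ∀ {n} → (Fin n → ℤ) → ℤ
sumFin {zero} f = + 0
sumFin {suc n} f = f zero + sumFin (λ i → f (suc i))

det : ∀ {n} → Matrix n → ℤ
det {zero} A = + 1
det {suc n} A = sumFin (λ j → sign (toℕ j) * (A zero j * det (minor A j)))

skewOf : ∀ {n} → (Fin n → Fin n → Bool) → Matrix n
skewOf a i j with i ≟ j
... | yes _ = + 0
... | no _ = if a i j then + 1 else - (+ 1)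

skew : ∀ {n} → Tournament n → Matrix n
skew T = skewOf (arc T)

detT : ∀ {n} → Tournament n → ℤ
detT T = det (skew T)

-- Induced subtournaments are given by injective maps f : Fin k → Fin n
-- (the vertex ordering does not affect the determinant of a principal
-- submatrix).
detSub : ∀ {n k} → Tournament n → (Fin k → Fin n) → ℤ
detSub T f = det (λ i j → skew T (f i) (f j))

InD1 : ∀ {n} → Tournament n → Set
InD1 {n} T = ∀ k (f : Fin k → Fin n) → Injective _≡_ _≡_ f → detSub T f ≤ + 1

-- Switch of an arc relation with respect to W ⊆ V (W given by its
-- characteristic function): arcs between W and its complement reversed.
switch : ∀ {n} → (Fin n → Bool) → (Fin n → Fin n → Bool) → (Fin n → Fin n → Bool)
switch W a i j = a i j xor (W i xor W j)

-- Isomorphism of arc relations on Fin m (only off-diagonal arcs matter):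
-- σ maps vertex i of the second to vertex σ i of the first.
IsoArc : ∀ {m} → (Fin m → Fin m → Bool) → (Fin m → Fin m → Bool) → Set
IsoArc {m} a b = Σ (Permutation′ m) λ σ → ∀ (i j : Fin m) → i ≢ j →
  a (σ ⟨$⟩ʳ i) (σ ⟨$⟩ʳ j) ≡ b i j

SwitchIso : ∀ {m} → (Fin m → Fin m → Bool) → (Fin m → Fin m → Bool) → Set
SwitchIso {m} a b = Σ (Fin m → Bool) λ W → IsoArc (switch W a) b

InXi : ∀ {m n} → Tournament m → Tournament n → Set
InXi {m} {n} H T = Σ (Fin m → Fin n) λ f → Injective _≡_ _≡_ f ×
  SwitchIso (λ i j → arc T (f i) (f j)) (arc H)

-- L₄ with v₁,v₂,v₃,v₄ = 0,1,2,3: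
-- v1→v2, v1→v3, v2→v3, v4→v1, v2→v4, v4→v3.
L4arc : Fin 4 → Fin 4 → Bool
L4arc zero (suc zero) = true
L4arc zero (suc (suc zero)) = true
L4arc (suc zero) (suc (suc zero)) = true
L4arc (suc (suc (suc zero))) zero = true
L4arc (suc zero) (suc (suc (suc zero))) = true
L4arc (suc (suc (suc zero))) (suc (suc zero)) = true
L4arc _ _ = false

L4tourn : ∀ i j → i ≢ j → L4arc i j ≡ not (L4arc j i)
L4tourn zero zero p = ⊥-elim (p refl)
L4tourn zero (suc zero) p = refl
L4tourn zero (suc (suc zero)) p = refl
L4tourn zero (suc (suc (suc zero))) p = refl
L4tourn (suc zero) zero p = refl
L4tourn (suc zero) (suc zero) p = ⊥-elim (p refl)
L4tourn (suc zero) (suc (suc zero)) p = refl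
L4tourn (suc zero) (suc (suc (suc zero))) p = refl
L4tourn (suc (suc zero)) zero p = refl
L4tourn (suc (suc zero)) (suc zero) p = refl
L4tourn (suc (suc zero)) (suc (suc zero)) p = ⊥-elim (p refl)
L4tourn (suc (suc zero)) (suc (suc (suc zero))) p = refl
L4tourn (suc (suc (suc zero))) zero p = refl
L4tourn (suc (suc (suc zero))) (suc zero) p = refl
L4tourn (suc (suc (suc zero))) (suc (suc zero)) p = refl
L4tourn (suc (suc (suc zero))) (suc (suc (suc zero))) p = ⊥-elim (p refl)

L4 : Tournament 4
L4 = record { arc = L4arc ; tourn = L4tourn }

-- Call x, a, b, c a switched triangle if a → b → c → a once T is switched at the
-- out-neighbourhood of x. Such a switch turns x into a sink, and a directed triangle with a
-- sink is L₄.
--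
-- If there is no switched triangle, the switch at any vertex x leaves the other vertices
-- transitive. Their source y satisfies S(y,w) = ε S(x,w) for every other w, where
-- ε = S(x,y) = ±1. So in the skew-adjacency matrix, row y and column y are ε times row x and
-- column x off the 2×2 block of x and y. Then det S = ε² det S′, where S′ omits x and y; this
-- uses only that the first-row expansion is alternating, since a two-row expansion is
-- antisymmetric in the rows. By induction every subtournament has determinant 0 or 1.
module Submission where

open import Defs
open import Data.Nat using (ℕ; zero; suc; z≤n; s≤s)
open import Data.Fin using (Fin; zero; suc; punchIn; toℕ; inject₁; _≟_)
open import Data.Fin.Properties
  using (toℕ-inject₁; suc-injective; 0≢1+n; punchInᵢ≢i; punchIn-injective; any?)
open import Data.Fin.Induction using (<-weakInduction)
open import Data.Vec.Functional using (_∷_; [])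
import Data.Fin.Permutation as Permutation
open import Data.Integer using (ℤ; +_; -_; _+_; _*_; _-_; _≤_; +≤+)
open import Data.Integer.Properties
  using ( neg-involutive; neg-distrib-+; neg-distribˡ-*; neg-distribʳ-*
        ; *-distribˡ-+; *-identityˡ; +-identityʳ; *-zeroʳ; *-assoc)
open import Data.Integer.Tactic.RingSolver using (solve-∀)
open import Data.Bool using (Bool; true; false; not; _xor_; if_then_else_)
import Data.Bool.Properties as Bool
open import Data.Bool.Properties using (not-distribˡ-xor; xor-comm)
open import Data.Product using (∃; _×_; _,_)
open import Data.Empty using (⊥; ⊥-elim)
open import Function using (_∘_; id)
open import Function.Definitions using (Congruent; Injective)
open import Relation.Nullary using (¬_; Dec; yes; no)
open import Relation.Nullary.Decidable using (_×-dec_; ¬?)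
open import Relation.Binary.PropositionalEquality

sign-suc : ∀ k → sign (suc k) ≡ - sign k
sign-suc zero = refl
sign-suc (suc k) = sym (trans (cong -_ (sign-suc k)) (neg-involutive (sign k)))

sign-pred : ∀ k → sign k ≡ - sign (suc k)
sign-pred k = sym (trans (cong -_ (sign-suc k)) (neg-involutive (sign k)))

self-neg⇒0 : ∀ (x : ℤ) → x ≡ - x → x ≡ + 0
self-neg⇒0 (+ zero) _ = refl
self-neg⇒0 (+ suc n) ()
self-neg⇒0 (Data.Integer.-[1+ n ]) ()

sumFin-cong : ∀ {n} {f g : Fin n → ℤ} → f ≗ g → sumFin f ≡ sumFin g
sumFin-cong {zero} _ = refl
sumFin-cong {suc n} f≗g = cong₂ _+_ (f≗g zero) (sumFin-cong (f≗g ∘ suc))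

sumFin-*ˡ : ∀ {n} a (f : Fin n → ℤ) → sumFin (λ i → a * f i) ≡ a * sumFin f
sumFin-*ˡ {zero} a f = sym (*-zeroʳ a)
sumFin-*ˡ {suc n} a f =
  trans (cong (_+_ (a * f zero)) (sumFin-*ˡ a (f ∘ suc))) (sym (*-distribˡ-+ a (f zero) _))

sumFin-neg : ∀ {n} (f : Fin n → ℤ) → sumFin (λ i → - f i) ≡ - sumFin f
sumFin-neg {zero} f = refl
sumFin-neg {suc n} f =
  trans (cong (_+_ (- f zero)) (sumFin-neg (f ∘ suc))) (sym (neg-distrib-+ (f zero) _))

sumFin-+ : ∀ {n} (f g : Fin n → ℤ) → sumFin (λ i → f i + g i) ≡ sumFin f + sumFin g
sumFin-+ {zero} f g = refl
sumFin-+ {suc n} f g =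
  trans (cong (_+_ (f zero + g zero)) (sumFin-+ (f ∘ suc) (g ∘ suc)))
        (interchange (f zero) (g zero) (sumFin (f ∘ suc)) (sumFin (g ∘ suc)))
  where
  interchange : ∀ a b c d → a + b + (c + d) ≡ a + c + (b + d)
  interchange = solve-∀

-- The transposition of the adjacent positions inject₁ c and suc c.
swap : ∀ {n} → Fin (suc n) → Fin (suc (suc n)) → Fin (suc (suc n))
swap zero zero = suc zero
swap zero (suc zero) = zero
swap zero (suc (suc j)) = suc (suc j)
swap {suc n} (suc c) zero = zero
swap {suc n} (suc c) (suc j) = suc (swap c j)

swap-inject₁ : ∀ {n} (c : Fin (suc n)) → swap c (inject₁ c) ≡ suc c
swap-inject₁ zero = refl
swap-inject₁ {suc n} (suc c) = cong suc (swap-inject₁ c)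

swap-suc : ∀ {n} (c : Fin (suc n)) → swap c (suc c) ≡ inject₁ c
swap-suc zero = refl
swap-suc {suc n} (suc c) = cong suc (swap-suc c)

swap-punchIn-inject₁ : ∀ {n} (c : Fin (suc n)) (j : Fin (suc n)) →
  swap c (punchIn (inject₁ c) j) ≡ punchIn (suc c) j
swap-punchIn-inject₁ zero zero = refl
swap-punchIn-inject₁ zero (suc j) = refl
swap-punchIn-inject₁ {suc n} (suc c) zero = refl
swap-punchIn-inject₁ {suc n} (suc c) (suc j) = cong suc (swap-punchIn-inject₁ c j)

swap-punchIn-suc : ∀ {n} (c : Fin (suc n)) (j : Fin (suc n)) →
  swap c (punchIn (suc c) j) ≡ punchIn (inject₁ c) j
swap-punchIn-suc zero zero = refl
swap-punchIn-suc zero (suc j) = refl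
swap-punchIn-suc {suc n} (suc c) zero = refl
swap-punchIn-suc {suc n} (suc c) (suc j) = cong suc (swap-punchIn-suc c j)

swap-fixes : ∀ {n} (c : Fin (suc n)) j → j ≢ inject₁ c → j ≢ suc c → swap c j ≡ j
swap-fixes zero zero j≢c _ = ⊥-elim (j≢c refl)
swap-fixes zero (suc zero) _ j≢c+1 = ⊥-elim (j≢c+1 refl)
swap-fixes zero (suc (suc j)) _ _ = refl
swap-fixes {suc n} (suc c) zero _ _ = refl
swap-fixes {suc n} (suc c) (suc j) j≢c j≢c+1 =
  cong suc (swap-fixes c j (j≢c ∘ cong suc) (j≢c+1 ∘ cong suc))

swap-moves-Fin2 : ∀ (c : Fin 1) (j : Fin 2) → j ≢ inject₁ c → j ≢ suc c → ⊥
swap-moves-Fin2 zero zero j≢c _ = j≢c refl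
swap-moves-Fin2 zero (suc zero) _ j≢c+1 = j≢c+1 refl

swap-punchIn : ∀ {n} (c : Fin (suc (suc n))) j → j ≢ inject₁ c → j ≢ suc c →
  ∃ λ c′ → swap c ∘ punchIn j ≗ punchIn j ∘ swap c′
swap-punchIn zero zero j≢c _ = ⊥-elim (j≢c refl)
swap-punchIn zero (suc zero) _ j≢c+1 = ⊥-elim (j≢c+1 refl)
swap-punchIn zero (suc (suc j)) _ _ =
  zero , λ { zero → refl ; (suc zero) → refl ; (suc (suc i)) → refl }
swap-punchIn (suc c) zero _ _ = c , λ _ → refl
swap-punchIn {zero} (suc c) (suc j) j≢c j≢c+1 =
  ⊥-elim (swap-moves-Fin2 c j (j≢c ∘ cong suc) (j≢c+1 ∘ cong suc))
swap-punchIn {suc n} (suc c) (suc j) j≢c j≢c+1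
  with c′ , commute ← swap-punchIn c j (j≢c ∘ cong suc) (j≢c+1 ∘ cong suc) =
  suc c′ , λ { zero → refl ; (suc i) → cong suc (commute i) }

sumFin-swap : ∀ {n} (c : Fin (suc n)) (f : Fin (suc (suc n)) → ℤ) →
  sumFin (f ∘ swap c) ≡ sumFin f
sumFin-swap zero f = exchange (f (suc zero)) (f zero) _
  where
  exchange : ∀ a b s → a + (b + s) ≡ b + (a + s)
  exchange = solve-∀
sumFin-swap {suc n} (suc c) f = cong (_+_ (f zero)) (sumFin-swap c (f ∘ suc))

det-cong : ∀ {n} {A B : Matrix n} → (∀ i j → A i j ≡ B i j) → det A ≡ det B
det-cong {zero} _ = refl
det-cong {suc n} A≡B = sumFin-cong λ j →
  cong₂ (λ a d → sign (toℕ j) * (a * d)) (A≡B zero j)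
        (det-cong λ r c → A≡B (suc r) (punchIn j c))

expand : ∀ {X : Set} {n} → (X → ℤ) → ((Fin n → X) → ℤ) → (Fin (suc n) → X) → ℤ
expand r Ψ κ = sumFin λ j → sign (toℕ j) * (r (κ j) * Ψ (κ ∘ punchIn j))

-- rowsDet R κ reduces to expand (R zero) (rowsDet (R ∘ suc)) κ and det A to
-- rowsDet A id; the proofs below use both conversions silently.
rowsDet : ∀ {X : Set} {n} → (Fin n → X → ℤ) → (Fin n → X) → ℤ
rowsDet R κ = det λ i j → R i (κ j)

module _ {X : Set} where

  ColumnCongruent : ∀ {n} → ((Fin n → X) → ℤ) → Set
  ColumnCongruent Ψ = Congruent _≗_ _≡_ Ψ

  rowsDet-cong : ∀ {n} (R : Fin n → X → ℤ) → ColumnCongruent (rowsDet R)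
  rowsDet-cong R κ≗κ′ = det-cong λ i j → cong (R i) (κ≗κ′ j)

  ∷-cong : ∀ {n} (x : X) {Ψ : (Fin (suc n) → X) → ℤ} →
    ColumnCongruent Ψ → ColumnCongruent (Ψ ∘ (x ∷_))
  ∷-cong x Ψ-cong g≗h = Ψ-cong λ { zero → refl ; (suc i) → g≗h i }

  expand-cong : ∀ {n} (r : X → ℤ) {Ψ : (Fin n → X) → ℤ} →
    ColumnCongruent Ψ → ColumnCongruent (expand r Ψ)
  expand-cong r Ψ-cong κ≗κ′ = sumFin-cong λ j →
    cong₂ (λ a d → sign (toℕ j) * (a * d)) (cong r (κ≗κ′ j)) (Ψ-cong (κ≗κ′ ∘ punchIn j))

  expand-cofactor-cong : ∀ {n} (r : X → ℤ) (Ψ Φ : (Fin n → X) → ℤ) κ →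
    (∀ j → Ψ (κ ∘ punchIn j) ≡ Φ (κ ∘ punchIn j)) → expand r Ψ κ ≡ expand r Φ κ
  expand-cofactor-cong r Ψ Φ κ Ψ≡Φ =
    sumFin-cong λ j → cong (λ d → sign (toℕ j) * (r (κ j) * d)) (Ψ≡Φ j)

  expand-cofactor-* : ∀ {n} (r : X → ℤ) a (Ψ : (Fin n → X) → ℤ) κ →
    expand r (λ g → a * Ψ g) κ ≡ a * expand r Ψ κ
  expand-cofactor-* r a Ψ κ =
    trans (sumFin-cong λ j → reorder (sign (toℕ j)) (r (κ j)) a (Ψ (κ ∘ punchIn j)))
          (sumFin-*ˡ a λ j → sign (toℕ j) * (r (κ j) * Ψ (κ ∘ punchIn j)))
    where
    reorder : ∀ s x a p → s * (x * (a * p)) ≡ a * (s * (x * p))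
    reorder = solve-∀

  expand-cofactor-neg : ∀ {n} (r : X → ℤ) (Ψ : (Fin n → X) → ℤ) κ →
    expand r (λ g → - Ψ g) κ ≡ - expand r Ψ κ
  expand-cofactor-neg r Ψ κ =
    trans (sumFin-cong λ j → reorder (sign (toℕ j)) (r (κ j)) (Ψ (κ ∘ punchIn j)))
          (sumFin-neg λ j → sign (toℕ j) * (r (κ j) * Ψ (κ ∘ punchIn j)))
    where
    reorder : ∀ s x p → s * (x * - p) ≡ - (s * (x * p))
    reorder = solve-∀

  expand-cofactor-linear : ∀ {n} (r : X → ℤ) a (Ψ Φ : (Fin n → X) → ℤ) (κ : Fin (suc n) → X) →
    expand r (λ g → a * Ψ g - Φ g) κ ≡ a * expand r Ψ κ - expand r Φ κ
  expand-cofactor-linear {n} r a Ψ Φ κ = begin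
    expand r (λ g → a * Ψ g - Φ g) κ
      ≡⟨ sumFin-cong (λ j → reorder (sign (toℕ j)) (r (κ j)) a
                                    (Ψ (κ ∘ punchIn j)) (Φ (κ ∘ punchIn j))) ⟩
    sumFin (λ j → a * term Ψ j + - term Φ j)
      ≡⟨ sumFin-+ (λ j → a * term Ψ j) (λ j → - term Φ j) ⟩
    sumFin (λ j → a * term Ψ j) + sumFin (λ j → - term Φ j)
      ≡⟨ cong₂ _+_ (sumFin-*ˡ a (term Ψ)) (sumFin-neg (term Φ)) ⟩
    a * expand r Ψ κ - expand r Φ κ ∎
    where
    open ≡-Reasoning
    term : ((Fin n → X) → ℤ) → Fin (suc n) → ℤ
    term Θ j = sign (toℕ j) * (r (κ j) * Θ (κ ∘ punchIn j))
    reorder : ∀ s x a p q → s * (x * (a * p - q)) ≡ a * (s * (x * p)) + - (s * (x * q))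
    reorder = solve-∀

  expand-row-* : ∀ {n} (r₀ r₁ : X → ℤ) a (Ψ : (Fin n → X) → ℤ) κ →
    (∀ j → r₁ (κ j) ≡ a * r₀ (κ j)) → expand r₁ Ψ κ ≡ a * expand r₀ Ψ κ
  expand-row-* r₀ r₁ a Ψ κ r₁≡ar₀ =
    trans (sumFin-cong λ j → trans (cong (λ x → sign (toℕ j) * (x * Ψ (κ ∘ punchIn j))) (r₁≡ar₀ j))
                                   (reorder (sign (toℕ j)) a (r₀ (κ j)) (Ψ (κ ∘ punchIn j))))
          (sumFin-*ˡ a λ j → sign (toℕ j) * (r₀ (κ j) * Ψ (κ ∘ punchIn j)))
    where
    reorder : ∀ s a x p → s * (a * x * p) ≡ a * (s * (x * p))
    reorder = solve-∀

  expand-first-column : ∀ {n} (r : X → ℤ) {Ψ : (Fin (suc n) → X) → ℤ} → ColumnCongruent Ψ →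
    ∀ κ → expand r Ψ κ ≡ r (κ zero) * Ψ (κ ∘ suc) - expand r (Ψ ∘ (κ zero ∷_)) (κ ∘ suc)
  expand-first-column {n} r {Ψ} Ψ-cong κ =
    cong₂ _+_ (*-identityˡ (r (κ zero) * Ψ (κ ∘ suc)))
              (trans (sumFin-cong later-column)
                     (sumFin-neg λ j → sign (toℕ j) * (r (κ (suc j)) * Ψ′ j)))
    where
    Ψ′ : Fin (suc n) → ℤ
    Ψ′ j = Ψ (κ zero ∷ (κ ∘ suc ∘ punchIn j))
    later-column : ∀ j → sign (toℕ (suc j)) * (r (κ (suc j)) * Ψ (κ ∘ punchIn (suc j)))
                       ≡ - (sign (toℕ j) * (r (κ (suc j)) * Ψ′ j))
    later-column j = begin
      sign (toℕ (suc j)) * (r (κ (suc j)) * Ψ (κ ∘ punchIn (suc j)))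
        ≡⟨ cong₂ (λ s d → s * (r (κ (suc j)) * d)) (sign-suc (toℕ j))
                 (Ψ-cong λ { zero → refl ; (suc c) → refl }) ⟩
      - sign (toℕ j) * (r (κ (suc j)) * Ψ′ j)
        ≡⟨ sym (neg-distribˡ-* (sign (toℕ j)) _) ⟩
      - (sign (toℕ j) * (r (κ (suc j)) * Ψ′ j)) ∎
      where open ≡-Reasoning

  expand-single-column : ∀ (r : X → ℤ) Ψ (κ : Fin 1 → X) → expand r Ψ κ ≡ r (κ zero) * Ψ (κ ∘ suc)
  expand-single-column r Ψ κ = trans (+-identityʳ _) (*-identityˡ _)

  expand₂ : ∀ {n} → (X → ℤ) → (X → ℤ) → ((Fin n → X) → ℤ) → (Fin (suc (suc n)) → X) → ℤ
  expand₂ r₀ r₁ Ψ = expand r₀ (expand r₁ Ψ)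

  -- The terms of expand₂ r₀ r₁ Ψ κ in which neither row meets the column κ zero.
  tail₂ : ∀ {n} → (X → ℤ) → (X → ℤ) → ((Fin n → X) → ℤ) → (Fin (suc (suc n)) → X) → ℤ
  tail₂ {zero} _ _ _ _ = + 0
  tail₂ {suc n} r₀ r₁ Ψ κ = expand₂ r₀ r₁ (Ψ ∘ (κ zero ∷_)) (κ ∘ suc)

  expand-cofactor-∷ : ∀ {n} (r₀ r₁ : X → ℤ) {Ψ : (Fin n → X) → ℤ} → ColumnCongruent Ψ → ∀ κ →
    expand r₀ (λ g → expand r₁ Ψ (κ zero ∷ g)) (κ ∘ suc)
      ≡ r₁ (κ zero) * expand r₀ Ψ (κ ∘ suc) - tail₂ r₀ r₁ Ψ κ
  expand-cofactor-∷ {zero} r₀ r₁ {Ψ} _ κ = begin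
    expand r₀ (λ g → expand r₁ Ψ (κ zero ∷ g)) (κ ∘ suc)
      ≡⟨ expand-cofactor-cong r₀ (λ g → expand r₁ Ψ (κ zero ∷ g)) (λ g → r₁ (κ zero) * Ψ g)
           (κ ∘ suc)
           (λ j → expand-single-column r₁ Ψ (κ zero ∷ (κ ∘ suc ∘ punchIn j))) ⟩
    expand r₀ (λ g → r₁ (κ zero) * Ψ g) (κ ∘ suc)
      ≡⟨ expand-cofactor-* r₀ (r₁ (κ zero)) Ψ (κ ∘ suc) ⟩
    r₁ (κ zero) * expand r₀ Ψ (κ ∘ suc)
      ≡⟨ sym (+-identityʳ _) ⟩
    r₁ (κ zero) * expand r₀ Ψ (κ ∘ suc) - + 0 ∎
    where open ≡-Reasoning
  expand-cofactor-∷ {suc n} r₀ r₁ {Ψ} Ψ-cong κ = begin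
    expand r₀ (λ g → expand r₁ Ψ (κ zero ∷ g)) (κ ∘ suc)
      ≡⟨ expand-cofactor-cong r₀ (λ g → expand r₁ Ψ (κ zero ∷ g))
           (λ g → r₁ (κ zero) * Ψ g - expand r₁ (Ψ ∘ (κ zero ∷_)) g) (κ ∘ suc)
           (λ j → expand-first-column r₁ Ψ-cong (κ zero ∷ (κ ∘ suc ∘ punchIn j))) ⟩
    expand r₀ (λ g → r₁ (κ zero) * Ψ g - expand r₁ (Ψ ∘ (κ zero ∷_)) g) (κ ∘ suc)
      ≡⟨ expand-cofactor-linear r₀ (r₁ (κ zero)) Ψ (expand r₁ (Ψ ∘ (κ zero ∷_))) (κ ∘ suc) ⟩
    r₁ (κ zero) * expand r₀ Ψ (κ ∘ suc) - tail₂ r₀ r₁ Ψ κ ∎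
    where open ≡-Reasoning

  expand₂-first-column : ∀ {n} (r₀ r₁ : X → ℤ) {Ψ : (Fin n → X) → ℤ} → ColumnCongruent Ψ → ∀ κ →
    expand₂ r₀ r₁ Ψ κ
      ≡ r₀ (κ zero) * expand r₁ Ψ (κ ∘ suc) - r₁ (κ zero) * expand r₀ Ψ (κ ∘ suc) + tail₂ r₀ r₁ Ψ κ
  expand₂-first-column r₀ r₁ {Ψ} Ψ-cong κ = begin
    expand₂ r₀ r₁ Ψ κ
      ≡⟨ expand-first-column r₀ (expand-cong r₁ Ψ-cong) κ ⟩
    r₀ (κ zero) * expand r₁ Ψ (κ ∘ suc) - expand r₀ (λ g → expand r₁ Ψ (κ zero ∷ g)) (κ ∘ suc)
      ≡⟨ cong (λ t → r₀ (κ zero) * expand r₁ Ψ (κ ∘ suc) - t) (expand-cofactor-∷ r₀ r₁ Ψ-cong κ) ⟩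
    r₀ (κ zero) * expand r₁ Ψ (κ ∘ suc) - (r₁ (κ zero) * expand r₀ Ψ (κ ∘ suc) - tail₂ r₀ r₁ Ψ κ)
      ≡⟨ regroup (r₀ (κ zero) * expand r₁ Ψ (κ ∘ suc)) (r₁ (κ zero) * expand r₀ Ψ (κ ∘ suc))
                 (tail₂ r₀ r₁ Ψ κ) ⟩
    r₀ (κ zero) * expand r₁ Ψ (κ ∘ suc) - r₁ (κ zero) * expand r₀ Ψ (κ ∘ suc) + tail₂ r₀ r₁ Ψ κ ∎
    where
    open ≡-Reasoning
    regroup : ∀ a b t → a - (b - t) ≡ a - b + t
    regroup = solve-∀

  expand₂-antisym : ∀ {n} (r₀ r₁ : X → ℤ) {Ψ : (Fin n → X) → ℤ} → ColumnCongruent Ψ → ∀ κ →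
    expand₂ r₀ r₁ Ψ κ ≡ - expand₂ r₁ r₀ Ψ κ
  tail₂-antisym : ∀ {n} (r₀ r₁ : X → ℤ) {Ψ : (Fin n → X) → ℤ} → ColumnCongruent Ψ → ∀ κ →
    tail₂ r₀ r₁ Ψ κ ≡ - tail₂ r₁ r₀ Ψ κ

  expand₂-antisym r₀ r₁ {Ψ} Ψ-cong κ = begin
    expand₂ r₀ r₁ Ψ κ
      ≡⟨ expand₂-first-column r₀ r₁ Ψ-cong κ ⟩
    a - b + tail₂ r₀ r₁ Ψ κ
      ≡⟨ cong (λ t → a - b + t) (tail₂-antisym r₀ r₁ Ψ-cong κ) ⟩
    a - b + - tail₂ r₁ r₀ Ψ κ
      ≡⟨ regroup a b (tail₂ r₁ r₀ Ψ κ) ⟩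
    - (b - a + tail₂ r₁ r₀ Ψ κ)
      ≡⟨ cong -_ (sym (expand₂-first-column r₁ r₀ Ψ-cong κ)) ⟩
    - expand₂ r₁ r₀ Ψ κ ∎
    where
    open ≡-Reasoning
    a b : ℤ
    a = r₀ (κ zero) * expand r₁ Ψ (κ ∘ suc)
    b = r₁ (κ zero) * expand r₀ Ψ (κ ∘ suc)
    regroup : ∀ a b t → a - b + - t ≡ - (b - a + t)
    regroup = solve-∀

  tail₂-antisym {zero} _ _ _ _ = refl
  tail₂-antisym {suc n} r₀ r₁ Ψ-cong κ = expand₂-antisym r₀ r₁ (∷-cong (κ zero) Ψ-cong) (κ ∘ suc)

  tail₂-proportional : ∀ {n} {r₀ r₁ : X → ℤ} a {Ψ : (Fin n → X) → ℤ} → ColumnCongruent Ψ → ∀ κ →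
    (∀ j → r₁ (κ (suc j)) ≡ a * r₀ (κ (suc j))) → tail₂ r₀ r₁ Ψ κ ≡ + 0
  tail₂-proportional {zero} _ _ _ _ = refl
  tail₂-proportional {suc n} {r₀} {r₁} a {Ψ} Ψ-cong κ r₁≡ar₀ = begin
    expand₂ r₀ r₁ Ψ′ (κ ∘ suc)
      ≡⟨ expand-cofactor-cong r₀ (expand r₁ Ψ′) (λ g → a * expand r₀ Ψ′ g) (κ ∘ suc)
           (λ j → expand-row-* r₀ r₁ a Ψ′ (κ ∘ suc ∘ punchIn j) (r₁≡ar₀ ∘ punchIn j)) ⟩
    expand r₀ (λ g → a * expand r₀ Ψ′ g) (κ ∘ suc)
      ≡⟨ expand-cofactor-* r₀ a (expand r₀ Ψ′) (κ ∘ suc) ⟩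
    a * expand₂ r₀ r₀ Ψ′ (κ ∘ suc)
      ≡⟨ cong (a *_) (self-neg⇒0 _ (expand₂-antisym r₀ r₀ (∷-cong (κ zero) Ψ-cong) (κ ∘ suc))) ⟩
    a * + 0
      ≡⟨ *-zeroʳ a ⟩
    + 0 ∎
    where
    open ≡-Reasoning
    Ψ′ : (Fin n → X) → ℤ
    Ψ′ = Ψ ∘ (κ zero ∷_)

  rowsDet-∷-* : ∀ {n} (R : Fin (suc n) → X → ℤ) a x y → (∀ i → R i x ≡ a * R i y) →
    ∀ g → rowsDet R (x ∷ g) ≡ a * rowsDet R (y ∷ g)
  rowsDet-∷-* {zero} R a x y Rx≡aRy g = begin
    rowsDet R (x ∷ g)         ≡⟨ expand-single-column (R zero) Φ (x ∷ g) ⟩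
    R zero x * + 1           ≡⟨ cong (_* + 1) (Rx≡aRy zero) ⟩
    a * R zero y * + 1       ≡⟨ *-assoc a (R zero y) (+ 1) ⟩
    a * (R zero y * + 1)     ≡⟨ cong (a *_) (sym (expand-single-column (R zero) Φ (y ∷ g))) ⟩
    a * rowsDet R (y ∷ g)    ∎
    where
    open ≡-Reasoning
    Φ : (Fin 0 → X) → ℤ
    Φ = rowsDet (R ∘ suc)
  rowsDet-∷-* {suc n} R a x y Rx≡aRy g = begin
    rowsDet R (x ∷ g)
      ≡⟨ expand-first-column (R zero) (rowsDet-cong (R ∘ suc)) (x ∷ g) ⟩
    R zero x * Φ g - expand (R zero) (Φ ∘ (x ∷_)) g
      ≡⟨ cong₂ _-_ (cong (_* Φ g) (Rx≡aRy zero))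
                   (trans (expand-cofactor-cong (R zero) (Φ ∘ (x ∷_)) (λ h → a * Φ (y ∷ h)) g
                            (λ j → rowsDet-∷-* (R ∘ suc) a x y (Rx≡aRy ∘ suc) (g ∘ punchIn j)))
                          (expand-cofactor-* (R zero) a (Φ ∘ (y ∷_)) g)) ⟩
    a * R zero y * Φ g - a * expand (R zero) (Φ ∘ (y ∷_)) g
      ≡⟨ factor a (R zero y) (Φ g) (expand (R zero) (Φ ∘ (y ∷_)) g) ⟩
    a * (R zero y * Φ g - expand (R zero) (Φ ∘ (y ∷_)) g)
      ≡⟨ cong (a *_) (sym (expand-first-column (R zero) (rowsDet-cong (R ∘ suc)) (y ∷ g))) ⟩
    a * rowsDet R (y ∷ g) ∎
    where
    open ≡-Reasoning
    Φ : (Fin (suc n) → X) → ℤ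
    Φ = rowsDet (R ∘ suc)
    factor : ∀ a b p e → a * b * p - a * e ≡ a * (b * p - e)
    factor = solve-∀

  rowsDet-swap-rows : ∀ {n} (R : Fin (suc (suc n)) → X → ℤ) (c : Fin (suc n)) κ →
    rowsDet (R ∘ swap c) κ ≡ - rowsDet R κ
  rowsDet-swap-rows R zero κ =
    expand₂-antisym (R (suc zero)) (R zero) (rowsDet-cong (λ i → R (suc (suc i)))) κ
  rowsDet-swap-rows {suc n} R (suc c) κ =
    trans (expand-cofactor-cong (R zero) (rowsDet (R ∘ swap (suc c) ∘ suc))
                                (λ g → - rowsDet (R ∘ suc) g) κ
             (λ j → rowsDet-swap-rows (R ∘ suc) c (κ ∘ punchIn j)))
          (expand-cofactor-neg (R zero) (rowsDet (R ∘ suc)) κ)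

  expand-swap : ∀ {n} (r : X → ℤ) {Ψ : (Fin (suc n) → X) → ℤ} → ColumnCongruent Ψ →
    ∀ κ (c : Fin (suc n)) →
    (∀ j → j ≢ inject₁ c → j ≢ suc c → Ψ (κ ∘ swap c ∘ punchIn j) ≡ - Ψ (κ ∘ punchIn j)) →
    expand r Ψ (κ ∘ swap c) ≡ - expand r Ψ κ
  expand-swap {n} r {Ψ} Ψ-cong κ c Ψ-alternates = begin
    expand r Ψ (κ ∘ swap c)        ≡⟨ sumFin-cong swapped-term ⟩
    sumFin (λ j → - term (swap c j)) ≡⟨ sumFin-neg (term ∘ swap c) ⟩
    - sumFin (term ∘ swap c)       ≡⟨ cong -_ (sumFin-swap c term) ⟩
    - expand r Ψ κ                 ∎
    where
    open ≡-Reasoning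
    term : Fin (suc (suc n)) → ℤ
    term i = sign (toℕ i) * (r (κ i) * Ψ (κ ∘ punchIn i))
    swapped-term : ∀ j → sign (toℕ j) * (r (κ (swap c j)) * Ψ (κ ∘ swap c ∘ punchIn j))
                       ≡ - term (swap c j)
    swapped-term j with j ≟ inject₁ c
    ... | yes refl rewrite swap-inject₁ c =
      trans (cong₂ (λ s p → s * (r (κ (suc c)) * p))
                   (trans (cong sign (toℕ-inject₁ c)) (sign-pred (toℕ c)))
                   (Ψ-cong (cong κ ∘ swap-punchIn-inject₁ c)))
            (sym (neg-distribˡ-* (sign (toℕ (suc c)))
                                 (r (κ (suc c)) * Ψ (κ ∘ punchIn (suc c)))))
    ... | no j≢c with j ≟ suc c
    ... | yes refl rewrite swap-suc c =
      trans (cong₂ (λ s p → s * (r (κ (inject₁ c)) * p))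
                   (trans (sign-suc (toℕ c)) (cong (-_ ∘ sign) (sym (toℕ-inject₁ c))))
                   (Ψ-cong (cong κ ∘ swap-punchIn-suc c)))
            (sym (neg-distribˡ-* (sign (toℕ (inject₁ c)))
                                 (r (κ (inject₁ c)) * Ψ (κ ∘ punchIn (inject₁ c)))))
    ... | no j≢c+1 rewrite swap-fixes c j j≢c j≢c+1 =
      trans (cong (λ p → sign (toℕ j) * (r (κ j) * p)) (Ψ-alternates j j≢c j≢c+1))
            (reorder (sign (toℕ j)) (r (κ j)) (Ψ (κ ∘ punchIn j)))
      where
      reorder : ∀ s x p → s * (x * - p) ≡ - (s * (x * p))
      reorder = solve-∀

  rowsDet-swap-columns : ∀ {n} (R : Fin (suc (suc n)) → X → ℤ) κ (c : Fin (suc n)) →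
    rowsDet R (κ ∘ swap c) ≡ - rowsDet R κ
  rowsDet-swap-columns {zero} R κ c =
    expand-swap (R zero) (rowsDet-cong (R ∘ suc)) κ c
      (λ j j≢c j≢c+1 → ⊥-elim (swap-moves-Fin2 c j j≢c j≢c+1))
  rowsDet-swap-columns {suc n} R κ c =
    expand-swap (R zero) (rowsDet-cong (R ∘ suc)) κ c minors-alternate
    where
    minors-alternate : ∀ j → j ≢ inject₁ c → j ≢ suc c →
      rowsDet (R ∘ suc) (κ ∘ swap c ∘ punchIn j) ≡ - rowsDet (R ∘ suc) (κ ∘ punchIn j)
    minors-alternate j j≢c j≢c+1 with c′ , commute ← swap-punchIn c j j≢c j≢c+1 =
      trans (rowsDet-cong (R ∘ suc) (cong κ ∘ commute))
            (rowsDet-swap-columns (R ∘ suc) (κ ∘ punchIn j) c′)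

det-conj-swap : ∀ {n} (A : Matrix (suc (suc n))) c → det (λ i j → A (swap c i) (swap c j)) ≡ det A
det-conj-swap A c = begin
  rowsDet (A ∘ swap c) (swap c) ≡⟨ rowsDet-swap-columns (A ∘ swap c) id c ⟩
  - rowsDet (A ∘ swap c) id     ≡⟨ cong -_ (rowsDet-swap-rows A c id) ⟩
  - - det A                     ≡⟨ neg-involutive (det A) ⟩
  det A                         ∎
  where open ≡-Reasoning

Skew : ∀ {n} → Matrix n → Set
Skew A = ∀ i j → A j i ≡ - A i j

skew-diag : ∀ {n} {A : Matrix n} → Skew A → ∀ i → A i i ≡ + 0
skew-diag A-skew i = self-neg⇒0 _ (A-skew i i)

-- Expand along rows 0 and 1. The block [[0, ε], [-ε, 0]] contributes ε² times the rest. Outside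
-- the block row 1 and column 1 are ε times row 0 and column 0, so the terms where row 1 meets
-- column 0 cancel those where row 0 meets column 1, and the terms avoiding both columns vanish.
det-eliminate-pair₀ : ∀ {n} (A : Matrix (suc (suc n))) ε → Skew A → A zero (suc zero) ≡ ε →
  (∀ z → A (suc zero) (suc (suc z)) ≡ ε * A zero (suc (suc z))) →
  det A ≡ ε * ε * det (λ r c → A (suc (suc r)) (suc (suc c)))
det-eliminate-pair₀ {zero} A ε A-skew A₀₁≡ε _ = begin
  det A
    ≡⟨ expand₂-first-column (A zero) (A (suc zero)) (rowsDet-cong (λ ())) id ⟩
  A zero zero * expand (A (suc zero)) Ψ suc - A (suc zero) zero * expand (A zero) Ψ suc + + 0
    ≡⟨ cong₂ (λ a b → a * expand (A (suc zero)) Ψ suc - b * expand (A zero) Ψ suc + + 0)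
             (skew-diag A-skew zero) (trans (A-skew zero (suc zero)) (cong -_ A₀₁≡ε)) ⟩
  + 0 * expand (A (suc zero)) Ψ suc - - ε * expand (A zero) Ψ suc + + 0
    ≡⟨ cong (λ e → + 0 * expand (A (suc zero)) Ψ suc - - ε * e + + 0)
            (trans (expand-single-column (A zero) Ψ suc) (cong (_* + 1) A₀₁≡ε)) ⟩
  + 0 * expand (A (suc zero)) Ψ suc - - ε * (ε * + 1) + + 0
    ≡⟨ simplify (expand (A (suc zero)) Ψ suc) ε ⟩
  ε * ε * + 1 ∎
  where
  open ≡-Reasoning
  Ψ : (Fin 0 → Fin 2) → ℤ
  Ψ = rowsDet λ ()
  simplify : ∀ e ε → + 0 * e - - ε * (ε * + 1) + + 0 ≡ ε * ε * + 1
  simplify = solve-∀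
det-eliminate-pair₀ {suc n} A ε A-skew A₀₁≡ε row = begin
  det A
    ≡⟨ expand₂-first-column (A zero) (A (suc zero)) (rowsDet-cong Rest) id ⟩
  A zero zero * E₁ - A (suc zero) zero * expand (A zero) Ψ suc + tail₂ (A zero) (A (suc zero)) Ψ id
    ≡⟨ cong₂ (λ a b → a * E₁ - b * expand (A zero) Ψ suc + tail₂ (A zero) (A (suc zero)) Ψ id)
             (skew-diag A-skew zero) (trans (A-skew zero (suc zero)) (cong -_ A₀₁≡ε)) ⟩
  + 0 * E₁ - - ε * expand (A zero) Ψ suc + tail₂ (A zero) (A (suc zero)) Ψ id
    ≡⟨ cong₂ (λ e t → + 0 * E₁ - - ε * e + t) first-row-cofactors tail-value ⟩
  + 0 * E₁ - - ε * (ε * P - ε * Y) + ε * (ε * Y)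
    ≡⟨ simplify E₁ ε P Y ⟩
  ε * ε * P ∎
  where
  open ≡-Reasoning
  skip₂ : Fin (suc n) → Fin (suc (suc (suc n)))
  skip₂ i = suc (suc i)
  Rest : Fin (suc n) → Fin (suc (suc (suc n))) → ℤ
  Rest i = A (suc (suc i))
  Ψ : (Fin (suc n) → Fin (suc (suc (suc n)))) → ℤ
  Ψ = rowsDet Rest
  Ψ′ : (Fin n → Fin (suc (suc (suc n)))) → ℤ
  Ψ′ = Ψ ∘ (zero ∷_)
  E₁ P Y : ℤ
  E₁ = expand (A (suc zero)) Ψ suc
  P = Ψ skip₂
  Y = expand (A zero) Ψ′ skip₂
  simplify : ∀ e ε p y → + 0 * e - - ε * (ε * p - ε * y) + ε * (ε * y) ≡ ε * ε * p
  simplify = solve-∀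

  column₁ : ∀ i → Rest i (suc zero) ≡ ε * Rest i zero
  column₁ i = begin
    A (suc (suc i)) (suc zero) ≡⟨ A-skew (suc zero) (suc (suc i)) ⟩
    - A (suc zero) (suc (suc i)) ≡⟨ cong -_ (row i) ⟩
    - (ε * A zero (suc (suc i))) ≡⟨ neg-distribʳ-* ε (A zero (suc (suc i))) ⟩
    ε * - A zero (suc (suc i))   ≡⟨ cong (ε *_) (sym (A-skew zero (suc (suc i)))) ⟩
    ε * A (suc (suc i)) zero     ∎

  first-row-cofactors : expand (A zero) Ψ suc ≡ ε * P - ε * Y
  first-row-cofactors = begin
    expand (A zero) Ψ suc
      ≡⟨ expand-first-column (A zero) (rowsDet-cong Rest) suc ⟩
    A zero (suc zero) * P - expand (A zero) (Ψ ∘ (suc zero ∷_)) skip₂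
      ≡⟨ cong₂ _-_ (cong (_* P) A₀₁≡ε)
           (trans (expand-cofactor-cong (A zero) (Ψ ∘ (suc zero ∷_)) (λ g → ε * Ψ′ g) skip₂
                     (λ j → rowsDet-∷-* Rest ε (suc zero) zero column₁ (skip₂ ∘ punchIn j)))
                  (expand-cofactor-* (A zero) ε Ψ′ skip₂)) ⟩
    ε * P - ε * Y ∎

  tail-value : tail₂ (A zero) (A (suc zero)) Ψ id ≡ ε * (ε * Y)
  tail-value = begin
    expand₂ (A zero) (A (suc zero)) Ψ′ suc
      ≡⟨ expand₂-first-column (A zero) (A (suc zero)) (∷-cong zero (rowsDet-cong Rest)) suc ⟩
    A zero (suc zero) * expand (A (suc zero)) Ψ′ skip₂
      - A (suc zero) (suc zero) * Y + tail₂ (A zero) (A (suc zero)) Ψ′ suc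
      ≡⟨ cong₂ (λ a t → a * expand (A (suc zero)) Ψ′ skip₂ - A (suc zero) (suc zero) * Y + t)
               A₀₁≡ε (tail₂-proportional ε (∷-cong zero (rowsDet-cong Rest)) suc row) ⟩
    ε * expand (A (suc zero)) Ψ′ skip₂ - A (suc zero) (suc zero) * Y + + 0
      ≡⟨ cong₂ (λ e d → ε * e - d * Y + + 0)
               (expand-row-* (A zero) (A (suc zero)) ε Ψ′ skip₂ row)
               (skew-diag A-skew (suc zero)) ⟩
    ε * (ε * Y) - + 0 * Y + + 0
      ≡⟨ drop-zeros (ε * (ε * Y)) Y ⟩
    ε * (ε * Y) ∎
    where
    drop-zeros : ∀ a y → a - + 0 * y + + 0 ≡ a
    drop-zeros = solve-∀

PairEliminable : ∀ {n} → Fin (suc n) → Set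
PairEliminable {n} m = ∀ (A : Matrix (suc (suc n))) ε → Skew A → A zero (suc m) ≡ ε →
  (∀ z → A (suc m) (suc (punchIn m z)) ≡ ε * A zero (suc (punchIn m z))) →
  det A ≡ ε * ε * det (λ r c → A (suc (punchIn m r)) (suc (punchIn m c)))

pairEliminable-suc : ∀ {n} (i : Fin n) → PairEliminable (inject₁ i) → PairEliminable (suc i)
pairEliminable-suc {suc n} i eliminable A ε A-skew A₀ₘ≡ε row = begin
  det A
    ≡⟨ sym (det-conj-swap A (suc i)) ⟩
  det A′
    ≡⟨ eliminable A′ ε (λ a b → A-skew (swap (suc i) a) (swap (suc i) b)) A′₀ₘ≡ε row′ ⟩
  ε * ε * det (λ r c → A′ (suc (punchIn (inject₁ i) r)) (suc (punchIn (inject₁ i) c)))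
    ≡⟨ cong (ε * ε *_) (det-cong λ r c →
         cong₂ (λ u v → A (suc u) (suc v)) (swap-punchIn-inject₁ i r) (swap-punchIn-inject₁ i c)) ⟩
  ε * ε * det (λ r c → A (suc (punchIn (suc i) r)) (suc (punchIn (suc i) c))) ∎
  where
  open ≡-Reasoning
  A′ : Matrix (suc (suc (suc n)))
  A′ a b = A (swap (suc i) a) (swap (suc i) b)
  A′₀ₘ≡ε : A′ zero (suc (inject₁ i)) ≡ ε
  A′₀ₘ≡ε = trans (cong (λ u → A zero (suc u)) (swap-inject₁ i)) A₀ₘ≡ε
  row′ : ∀ z → A′ (suc (inject₁ i)) (suc (punchIn (inject₁ i) z))
             ≡ ε * A′ zero (suc (punchIn (inject₁ i) z))
  row′ z = begin
    A (suc (swap i (inject₁ i))) (suc (swap i (punchIn (inject₁ i) z)))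
      ≡⟨ cong₂ (λ u v → A (suc u) (suc v)) (swap-inject₁ i) (swap-punchIn-inject₁ i z) ⟩
    A (suc (suc i)) (suc (punchIn (suc i) z))
      ≡⟨ row z ⟩
    ε * A zero (suc (punchIn (suc i) z))
      ≡⟨ cong (λ v → ε * A zero (suc v)) (sym (swap-punchIn-inject₁ i z)) ⟩
    ε * A zero (suc (swap i (punchIn (inject₁ i) z))) ∎

det-eliminate-pair : ∀ {n} (m : Fin (suc n)) → PairEliminable m
det-eliminate-pair = <-weakInduction PairEliminable det-eliminate-pair₀ pairEliminable-suc

sgn : Bool → ℤ
sgn b = if b then + 1 else - + 1

sgn-not : ∀ b → sgn (not b) ≡ - sgn b
sgn-not true = refl
sgn-not false = refl

sgn-square : ∀ b → sgn b * sgn b ≡ + 1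
sgn-square true = refl
sgn-square false = refl

sgn-xor : ∀ p q r → p xor (q xor r) ≡ true → sgn p ≡ sgn q * sgn r
sgn-xor true true true _ = refl
sgn-xor true false false _ = refl
sgn-xor false true false _ = refl
sgn-xor false false true _ = refl
sgn-xor true true false ()
sgn-xor true false true ()
sgn-xor false true true ()
sgn-xor false false false ()

module _ {n} (T : Tournament n) where

  skew-refl : ∀ u → skew T u u ≡ + 0
  skew-refl u with u ≟ u
  ... | yes _ = refl
  ... | no u≢u = ⊥-elim (u≢u refl)

  skew-≢ : ∀ {u v} → u ≢ v → skew T u v ≡ sgn (arc T u v)
  skew-≢ {u} {v} u≢v with u ≟ v
  ... | yes u≡v = ⊥-elim (u≢v u≡v)
  ... | no _ = refl

  skew-skew : Skew (skew T)
  skew-skew u v = by-cases (u ≟ v)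
    where
    open ≡-Reasoning
    by-cases : Dec (u ≡ v) → skew T v u ≡ - skew T u v
    by-cases (yes refl) = trans (skew-refl u) (cong -_ (sym (skew-refl u)))
    by-cases (no u≢v) = begin
      skew T v u               ≡⟨ skew-≢ (u≢v ∘ sym) ⟩
      sgn (arc T v u)          ≡⟨ cong sgn (tourn T v u (u≢v ∘ sym)) ⟩
      sgn (not (arc T u v))    ≡⟨ sgn-not (arc T u v) ⟩
      - sgn (arc T u v)        ≡⟨ cong -_ (sym (skew-≢ u≢v)) ⟩
      - skew T u v             ∎

  skew-square : ∀ {u v} → u ≢ v → skew T u v * skew T u v ≡ + 1
  skew-square {u} {v} u≢v rewrite skew-≢ u≢v = sgn-square (arc T u v)

  skew-switch : ∀ {u v w} → u ≢ v → u ≢ w → v ≢ w → switch (arc T u) (arc T) v w ≡ true →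
    skew T v w ≡ skew T u v * skew T u w
  skew-switch {u} {v} {w} u≢v u≢w v≢w vw rewrite skew-≢ u≢v | skew-≢ u≢w | skew-≢ v≢w =
    sgn-xor (arc T v w) (arc T u v) (arc T u w) vw

  arc-flip : ∀ {u v} → u ≢ v → arc T u v ≡ false → arc T v u ≡ true
  arc-flip u≢v uv = trans (tourn T _ _ (u≢v ∘ sym)) (cong not uv)

induced : ∀ {n k} (T : Tournament n) (f : Fin k → Fin n) → Injective _≡_ _≡_ f → Tournament k
induced T f f-inj = record
  { arc = λ i j → arc T (f i) (f j)
  ; tourn = λ i j i≢j → tourn T (f i) (f j) (i≢j ∘ f-inj)
  }

switched : ∀ {n} → (Fin n → Bool) → Tournament n → Tournament n
switched W T = record
  { arc = switch W (arc T)
  ; tourn = λ i j i≢j → begin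
      arc T i j xor (W i xor W j)         ≡⟨ cong (_xor (W i xor W j)) (tourn T i j i≢j) ⟩
      not (arc T j i) xor (W i xor W j)   ≡⟨ sym (not-distribˡ-xor (arc T j i) _) ⟩
      not (arc T j i xor (W i xor W j))   ≡⟨ cong (not ∘ (arc T j i xor_)) (xor-comm (W i) (W j)) ⟩
      not (arc T j i xor (W j xor W i))   ∎
  }
  where open ≡-Reasoning

Triangle : ∀ {n} → Tournament n → Fin n → Fin n → Fin n → Set
Triangle T a b c =
  a ≢ b × b ≢ c × c ≢ a × arc T a b ≡ true × arc T b c ≡ true × arc T c a ≡ true

triangle? : ∀ {n} (T : Tournament n) a b c → Dec (Triangle T a b c)
triangle? T a b c =
  ¬? (a ≟ b) ×-dec ¬? (b ≟ c) ×-dec ¬? (c ≟ a) ×-dec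
  (arc T a b Bool.≟ true) ×-dec (arc T b c Bool.≟ true) ×-dec (arc T c a Bool.≟ true)

triangle-induced : ∀ {n k} (T : Tournament n) {f : Fin k → Fin n} (f-inj : Injective _≡_ _≡_ f) →
  ∀ {a b c} → Triangle (induced T f f-inj) a b c → Triangle T (f a) (f b) (f c)
triangle-induced T f-inj (a≢b , b≢c , c≢a , ab , bc , ca) =
  a≢b ∘ f-inj , b≢c ∘ f-inj , c≢a ∘ f-inj , ab , bc , ca

triangle-free⇒source : ∀ {n} (T : Tournament (suc n)) → (∀ a b c → ¬ Triangle T a b c) →
  ∃ λ y → ∀ w → w ≢ y → arc T y w ≡ true
triangle-free⇒source {zero} T _ = zero , λ { zero 0≢0 → ⊥-elim (0≢0 refl) }
triangle-free⇒source {suc n} T triangle-free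
  with y , y-source ← triangle-free⇒source (induced T suc suc-injective) (λ a b c →
                        triangle-free (suc a) (suc b) (suc c) ∘ triangle-induced T suc-injective)
  with arc T (suc y) zero in y→0
... | true = suc y , λ { zero _ → y→0 ; (suc w) w≢y → y-source w (w≢y ∘ cong suc) }
... | false = zero , λ { zero 0≢0 → ⊥-elim (0≢0 refl) ; (suc w) _ → 0→ w }
  where
  0→y : arc T zero (suc y) ≡ true
  0→y = arc-flip T (λ ()) y→0
  0→ : ∀ w → arc T zero (suc w) ≡ true
  0→ w with w ≟ y
  ... | yes refl = 0→y
  ... | no w≢y with arc T zero (suc w) in 0w
  ...   | true = refl
  ...   | false = ⊥-elim (triangle-free zero (suc y) (suc w)
                   ( (λ ()) , w≢y ∘ sym ∘ suc-injective , (λ ())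
                   , 0→y , y-source w w≢y , arc-flip T (λ ()) 0w))

SwitchedTriangle : ∀ {n} → Tournament n → Set
SwitchedTriangle T = ∃ λ x → ∃ λ a → ∃ λ b → ∃ λ c →
  x ≢ a × x ≢ b × x ≢ c × Triangle (switched (arc T x) T) a b c

switchedTriangle? : ∀ {n} (T : Tournament n) → Dec (SwitchedTriangle T)
switchedTriangle? T = any? λ x → any? λ a → any? λ b → any? λ c →
  ¬? (x ≟ a) ×-dec ¬? (x ≟ b) ×-dec ¬? (x ≟ c) ×-dec triangle? (switched (arc T x) T) a b c

module _ {n} (T : Tournament n) (no-switched-triangle : ¬ SwitchedTriangle T) where

  switched-source : ∀ {k} (f : Fin (suc (suc k)) → Fin n) → Injective _≡_ _≡_ f →
    ∃ λ m → ∀ w → w ≢ m → switch (arc T (f zero)) (arc T) (f (suc m)) (f (suc w)) ≡ true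
  switched-source f f-inj =
    triangle-free⇒source (induced (switched (arc T (f zero)) T) (f ∘ suc) (suc-injective ∘ f-inj))
      λ a b c Δ → no-switched-triangle
        ( f zero , f (suc a) , f (suc b) , f (suc c)
        , 0≢1+n ∘ f-inj , 0≢1+n ∘ f-inj , 0≢1+n ∘ f-inj
        , triangle-induced (switched (arc T (f zero)) T) (suc-injective ∘ f-inj) Δ)

  detSub-eliminate-pair : ∀ {k} (f : Fin (suc (suc k)) → Fin n) → Injective _≡_ _≡_ f →
    ∃ λ (f′ : Fin k → Fin n) → Injective _≡_ _≡_ f′ × detSub T f ≡ detSub T f′
  detSub-eliminate-pair {k} f f-inj with m , m-source ← switched-source f f-inj =
    f′ , punchIn-injective m _ _ ∘ suc-injective ∘ f-inj , (begin
      detSub T f           ≡⟨ det-eliminate-pair m M ε (λ i j → skew-skew T (f i) (f j)) refl row ⟩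
      ε * ε * detSub T f′  ≡⟨ cong (_* detSub T f′) (skew-square T x≢y) ⟩
      + 1 * detSub T f′    ≡⟨ *-identityˡ (detSub T f′) ⟩
      detSub T f′          ∎)
    where
    open ≡-Reasoning
    M : Matrix (suc (suc k))
    M i j = skew T (f i) (f j)
    x≢y : f zero ≢ f (suc m)
    x≢y = 0≢1+n ∘ f-inj
    ε : ℤ
    ε = skew T (f zero) (f (suc m))
    f′ : Fin k → Fin n
    f′ = f ∘ suc ∘ punchIn m
    row : ∀ z → M (suc m) (suc (punchIn m z)) ≡ ε * M zero (suc (punchIn m z))
    row z = skew-switch T x≢y (0≢1+n ∘ f-inj) (punchInᵢ≢i m z ∘ sym ∘ suc-injective ∘ f-inj)
                        (m-source (punchIn m z) (punchInᵢ≢i m z))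

  switchedTriangle-free⇒D1 : InD1 T
  switchedTriangle-free⇒D1 zero f _ = +≤+ (s≤s z≤n)
  switchedTriangle-free⇒D1 (suc zero) f _ rewrite skew-refl T (f zero) = +≤+ z≤n
  switchedTriangle-free⇒D1 (suc (suc k)) f f-inj
    with f′ , f′-inj , f≡f′ ← detSub-eliminate-pair f f-inj =
    subst (_≤ + 1) (sym f≡f′) (switchedTriangle-free⇒D1 k f′ f′-inj)

∷-injective : ∀ {A : Set} {k} {x : A} {g : Fin k → A} →
  Injective _≡_ _≡_ g → (∀ i → x ≢ g i) → Injective _≡_ _≡_ (x ∷ g)
∷-injective g-inj x-fresh {zero} {zero} _ = refl
∷-injective g-inj x-fresh {zero} {suc j} x≡gj = ⊥-elim (x-fresh j x≡gj)
∷-injective g-inj x-fresh {suc i} {zero} gi≡x = ⊥-elim (x-fresh i (sym gi≡x))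
∷-injective g-inj x-fresh {suc i} {suc j} gi≡gj = cong suc (g-inj gi≡gj)

switch-sink : ∀ {n} (T : Tournament n) {x u} → u ≢ x →
  arc T u x xor (arc T x u xor false) ≡ true
switch-sink T {x} {u} u≢x rewrite tourn T u x u≢x = not-xor-self (arc T x u)
  where
  not-xor-self : ∀ p → not p xor (p xor false) ≡ true
  not-xor-self true = refl
  not-xor-self false = refl

agree-by-flip : ∀ {k} (S H : Tournament k) {i j} → i ≢ j →
  arc S j i ≡ arc H j i → arc S i j ≡ arc H i j
agree-by-flip S H i≢j ji = trans (tourn S _ _ i≢j) (trans (cong not ji) (sym (tourn H _ _ i≢j)))

-- W is the out-neighbourhood of x (W x = false makes x the sink); in the order a, b, x, c
-- the switched vertices are v₁, v₂, v₃, v₄ of L₄.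
switchedTriangle⇒L4 : ∀ {n} (T : Tournament n) → SwitchedTriangle T → InXi L4 T
switchedTriangle⇒L4 {n} T (x , a , b , c , x≢a , x≢b , x≢c , a≢b , b≢c , c≢a , a→b , b→c , c→a) =
  f , f-inj , W , Permutation.id , agree
  where
  f : Fin 4 → Fin n
  f = a ∷ b ∷ x ∷ c ∷ []
  f-inj : Injective _≡_ _≡_ f
  f-inj = ∷-injective (∷-injective (∷-injective (∷-injective (λ { {()} }) λ ())
                                                 λ { zero → x≢c ; (suc ()) })
                                   λ { zero → x≢b ∘ sym ; (suc zero) → b≢c ; (suc (suc ())) })
                      λ { zero → a≢b ; (suc zero) → x≢a ∘ sym ; (suc (suc zero)) → c≢a ∘ sym
                        ; (suc (suc (suc ()))) }
  W : Fin 4 → Bool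
  W = arc T x a ∷ arc T x b ∷ false ∷ arc T x c ∷ []
  S : Tournament 4
  S = switched W (induced T f f-inj)
  agree : ∀ i j → i ≢ j → arc S i j ≡ L4arc i j
  agree zero (suc zero) _ = a→b
  agree zero (suc (suc zero)) _ = switch-sink T (x≢a ∘ sym)
  agree (suc zero) (suc (suc zero)) _ = switch-sink T (x≢b ∘ sym)
  agree (suc zero) (suc (suc (suc zero))) _ = b→c
  agree (suc (suc (suc zero))) zero _ = c→a
  agree (suc (suc (suc zero))) (suc (suc zero)) _ = switch-sink T (x≢c ∘ sym)
  agree zero (suc (suc (suc zero))) i≢j = agree-by-flip S L4 i≢j (agree _ _ (i≢j ∘ sym))
  agree (suc zero) zero i≢j = agree-by-flip S L4 i≢j (agree _ _ (i≢j ∘ sym))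
  agree (suc (suc zero)) zero i≢j = agree-by-flip S L4 i≢j (agree _ _ (i≢j ∘ sym))
  agree (suc (suc zero)) (suc zero) i≢j = agree-by-flip S L4 i≢j (agree _ _ (i≢j ∘ sym))
  agree (suc (suc zero)) (suc (suc (suc zero))) i≢j = agree-by-flip S L4 i≢j (agree _ _ (i≢j ∘ sym))
  agree (suc (suc (suc zero))) (suc zero) i≢j = agree-by-flip S L4 i≢j (agree _ _ (i≢j ∘ sym))
  agree zero zero i≢i = ⊥-elim (i≢i refl)
  agree (suc zero) (suc zero) i≢i = ⊥-elim (i≢i refl)
  agree (suc (suc zero)) (suc (suc zero)) i≢i = ⊥-elim (i≢i refl)
  agree (suc (suc (suc zero))) (suc (suc (suc zero))) i≢i = ⊥-elim (i≢i refl)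

proposition5p2 : ∀ (n : ℕ) (T : Tournament n) → ¬ InD1 T → InXi L4 T
proposition5p2 n T T∉D₁ with switchedTriangle? T
... | yes Δ = switchedTriangle⇒L4 T Δ
... | no ¬Δ = ⊥-elim (T∉D₁ (switchedTriangle-free⇒D1 T ¬Δ))
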